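{- Let $M$ be a matroid on a finite ground set $E$, and let $X\subseteq E$ be a series class of $M$ with $|X|=p+1$, where $p\ge 0$ is an integer. If $X$ is not a circuit of $M$, then \[ T_M(x,y) = (x^{p}+x^{p-1}+\cdots+x+1)\,T_{M\setminus X}(x,y) + T_{M/X}(x,y), \] where $M\setminus X$ and $M/X$ denote the deletion and contraction of the set $X$ from $M$.
   Context: For a matroid $M=(E,r)$ with rank function $r$, the Tutte polynomial is $T_M(x,y)=\sum_{A\subseteq E}(x-1)^{r(E)-r(A)}(y-1)^{|A|-r(A)}$. A parallel class of a matroid $N$ is a maximal subset $X$ of $E(N)$ such that any two distinct members of $X$ are parallel in $N$ and no member of $X$ is a loop of $N$. A series class of $M$ is a parallel class of the dual matroid $M^{*}$. -}

module Defs where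

open import Level using (Level)
open import Data.Nat using (ℕ; zero; suc; _∸_; _≤_; _<_)
open import Data.Nat as Nat using ()
open import Data.Bool using (true; false)
open import Data.Fin using (Fin)
open import Data.Fin.Subset using (Subset; _⊆_; _∪_; _∩_; ∁; ∣_∣; ⁅_⁆; _∈_; _∉_; ⊤)
open import Data.Fin.Subset as Sub using ()
open import Data.Vec using ([]; _∷_)
open import Data.List using (List; []; _∷_; map; _++_)
open import Data.Product using (_×_)
open import Relation.Binary.PropositionalEquality using (_≡_)
open import Relation.Nullary using (¬_)
open import Algebra.Bundles using (CommutativeRing)

-- Matroids on the ground set E = Fin n, given by their rank function.

record IsMatroidRank {n : ℕ} (r : Subset n → ℕ) : Set where
  field
    rank-≤-card : ∀ A → r A ≤ ∣ A ∣
    rank-mono   : ∀ {A B} → A ⊆ B → r A ≤ r B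
    rank-submod : ∀ A B → r (A ∪ B) Nat.+ r (A ∩ B) ≤ r A Nat.+ r B

record Matroid (n : ℕ) : Set where
  field
    rank    : Subset n → ℕ
    isRank  : IsMatroidRank rank

dualRank : ∀ {n} → (Subset n → ℕ) → Subset n → ℕ
dualRank r A = (∣ A ∣ Nat.+ r (∁ A)) ∸ r ⊤

Dependent : ∀ {n} → (Subset n → ℕ) → Subset n → Set
Dependent r A = r A < ∣ A ∣

Independent : ∀ {n} → (Subset n → ℕ) → Subset n → Set
Independent r A = r A ≡ ∣ A ∣

Circuit : ∀ {n} → (Subset n → ℕ) → Subset n → Set
Circuit r C = Dependent r C × (∀ e → e ∈ C → Independent r (C Sub.- e))

Loop : ∀ {n} → (Subset n → ℕ) → Fin n → Set
Loop r e = Circuit r ⁅ e ⁆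

Parallel : ∀ {n} → (Subset n → ℕ) → Fin n → Fin n → Set
Parallel r e f = ¬ (e ≡ f) × Circuit r (⁅ e ⁆ ∪ ⁅ f ⁆)

ParallelSet : ∀ {n} → (Subset n → ℕ) → Subset n → Set
ParallelSet r X =
  (∀ e f → e ∈ X → f ∈ X → ¬ (e ≡ f) → Parallel r e f) × (∀ e → e ∈ X → ¬ Loop r e)

ParallelClass : ∀ {n} → (Subset n → ℕ) → Subset n → Set
ParallelClass r X = ParallelSet r X × (∀ Y → X ⊆ Y → ParallelSet r Y → Y ≡ X)

SeriesClass : ∀ {n} → Matroid n → Subset n → Set
SeriesClass M X = ParallelClass (dualRank (Matroid.rank M)) X

subsetsOf : ∀ {n} → Subset n → List (Subset n)
subsetsOf [] = [] ∷ []
subsetsOf (false ∷ S) = map (false ∷_) (subsetsOf S)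
subsetsOf (true  ∷ S) = map (false ∷_) (subsetsOf S) ++ map (true ∷_) (subsetsOf S)

-- Tutte polynomial, evaluated in an arbitrary commutative ring
-- (an identity of polynomials in ℤ[x,y] is the same as an identity
-- holding for all x, y in every commutative ring).

module TutteIn {c ℓ : Level} (R : CommutativeRing c ℓ) where
  open CommutativeRing R

  pow : Carrier → ℕ → Carrier
  pow x zero    = 1#
  pow x (suc k) = x * pow x k

  geom : Carrier → ℕ → Carrier
  geom x zero    = 1#
  geom x (suc p) = pow x (suc p) + geom x p

  sumL : List Carrier → Carrier
  sumL []       = 0#
  sumL (a ∷ as) = a + sumL as

  -- Tutte polynomial of the matroid with ground set S ⊆ Fin n and rank
  -- function ρ (only its values on subsets of S matter):
  -- Σ_{A ⊆ S} (x-1)^{ρ(S)-ρ(A)} (y-1)^{|A|-ρ(A)}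
  tutteOn : ∀ {n} → Subset n → (Subset n → ℕ) → Carrier → Carrier → Carrier
  tutteOn S ρ x y =
    sumL (map (λ A → pow (x + (- 1#)) (ρ S ∸ ρ A) * pow (y + (- 1#)) (∣ A ∣ ∸ ρ A))
              (subsetsOf S))

  tutte : ∀ {n} → Matroid n → Carrier → Carrier → Carrier
  tutte M = tutteOn ⊤ (Matroid.rank M)

  tutteDelete : ∀ {n} → Matroid n → Subset n → Carrier → Carrier → Carrier
  tutteDelete M X = tutteOn (∁ X) (Matroid.rank M)

  tutteContract : ∀ {n} → Matroid n → Subset n → Carrier → Carrier → Carrier
  tutteContract M X = tutteOn (∁ X) (λ A → Matroid.rank M (A ∪ X) ∸ Matroid.rank M X)

module Submission where

-- Every A ⊆ E
-- splits uniquely as A = B ∪ Y with B ⊆ E − X and Y ⊆ X, so the Tutte sum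
-- becomes a double sum over B and Y.  The members of X are pairwise in series
-- and none is a coloop, so adding a member e of X to a set avoiding e and
-- some other member of X raises the rank by one; hence r(B ∪ Y) = r(B) + |Y|
-- for every proper subset Y of X.  As X is not a circuit this gives r(X) = |X|, and
-- r(E) = r(E − X) + p.  Therefore the summand of B ∪ Y with Y ⊂ X is the
-- summand of B in T_{M\X} times (x−1)^{p−|Y|}, and the summand of B ∪ X is
-- the summand of B in T_{M/X}; by the binomial theorem the powers
-- (x−1)^{p−|Y|} over the proper subsets Y of X add up to x^p + ... + 1.

open import Defs
open import Level using (Level)
open import Function using (_∘_)
open import Data.Nat using (ℕ; zero; suc; _∸_; _≤_; _<_; s≤s⁻¹)
open import Data.Bool using (true; false)
open import Data.Fin using () renaming (zero to fzero; suc to fsuc)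
open import Data.Fin.Properties using () renaming (_≟_ to _≟ᶠ_)
open import Data.Fin.Subset
open import Data.Fin.Subset.Properties
open import Data.Vec using ([]; _∷_; here; there)
open import Data.List using ([]; _∷_; map; _++_)
open import Data.Product using (_,_; proj₁; proj₂)
open import Data.Sum using ([_,_])
open import Data.Empty using (⊥-elim)
open import Relation.Binary.PropositionalEquality
  using (_≡_; _≢_; refl; sym; trans; cong; cong₂; subst; module ≡-Reasoning)
open import Relation.Nullary using (¬_; yes; no)
open import Algebra.Bundles using (CommutativeRing)

module Cardinality where
  open import Data.Nat using (_+_)
  open import Data.Nat.Properties using (+-suc)

  nonempty : ∀ {n} (p : Subset n) {m} → ∣ p ∣ ≡ suc m → Nonempty p
  nonempty (true  ∷ p) _ = fzero , here
  nonempty (false ∷ p) |p|≡1+m with nonempty p |p|≡1+m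
  ... | x , x∈p = fsuc x , there x∈p

  ∣p∣≡0⇒p≡⊥ : ∀ {n} (p : Subset n) → ∣ p ∣ ≡ 0 → p ≡ ⊥
  ∣p∣≡0⇒p≡⊥ []          _      = refl
  ∣p∣≡0⇒p≡⊥ (false ∷ p) |p|≡0 = cong (false ∷_) (∣p∣≡0⇒p≡⊥ p |p|≡0)

  ∣p-x∣+1≡∣p∣ : ∀ {n} (p : Subset n) {x} → x ∈ p → suc ∣ p - x ∣ ≡ ∣ p ∣
  ∣p-x∣+1≡∣p∣ (true  ∷ p) here      = cong (λ q → suc ∣ q ∣) (p─⊥≡p p)
  ∣p-x∣+1≡∣p∣ (true  ∷ p) (there h) = cong suc (∣p-x∣+1≡∣p∣ p h)
  ∣p-x∣+1≡∣p∣ (false ∷ p) (there h) = ∣p-x∣+1≡∣p∣ p h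

  x∈p─q⇒x∉q : ∀ {n} (p q : Subset n) {x} → x ∈ p ─ q → x ∉ q
  x∈p─q⇒x∉q (true ∷ p) (false ∷ q) here      ()
  x∈p─q⇒x∉q (_    ∷ p) (true  ∷ q) (there h) = x∈p─q⇒x∉q p q h ∘ drop-there
  x∈p─q⇒x∉q (_    ∷ p) (false ∷ q) (there h) = x∈p─q⇒x∉q p q h ∘ drop-there

  x∉p-x : ∀ {n} (p : Subset n) x → x ∉ p - x
  x∉p-x p x x∈p-x = x∈p─q⇒x∉q p ⁅ x ⁆ x∈p-x (x∈⁅x⁆ x)

  p-x∪⁅x⁆≡p : ∀ {n} {p : Subset n} {x} → x ∈ p → (p - x) ∪ ⁅ x ⁆ ≡ p
  p-x∪⁅x⁆≡p {p = true  ∷ p} here      =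
    cong (true ∷_) (trans (∪-identityʳ (p ─ ⊥)) (p─⊥≡p p))
  p-x∪⁅x⁆≡p {p = true  ∷ p} (there h) = cong (true ∷_) (p-x∪⁅x⁆≡p h)
  p-x∪⁅x⁆≡p {p = false ∷ p} (there h) = cong (false ∷_) (p-x∪⁅x⁆≡p h)

  ∉∪ : ∀ {n} {p q : Subset n} {x} → x ∉ p → x ∉ q → x ∉ p ∪ q
  ∉∪ {p = p} {q} x∉p x∉q = [ x∉p , x∉q ] ∘ x∈p∪q⁻ p q

  ∣p∪q∣≡∣p∣+∣q∣ : ∀ {n} (p q : Subset n) → (∀ {x} → x ∈ p → x ∉ q) →
    ∣ p ∪ q ∣ ≡ ∣ p ∣ + ∣ q ∣
  ∣p∪q∣≡∣p∣+∣q∣ []          []          _        = refl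
  ∣p∪q∣≡∣p∣+∣q∣ (true  ∷ p) (true  ∷ q) disjoint = ⊥-elim (disjoint here here)
  ∣p∪q∣≡∣p∣+∣q∣ (true  ∷ p) (false ∷ q) disjoint =
    cong suc (∣p∪q∣≡∣p∣+∣q∣ p q (λ x∈p x∈q → disjoint (there x∈p) (there x∈q)))
  ∣p∪q∣≡∣p∣+∣q∣ (false ∷ p) (true  ∷ q) disjoint =
    trans (cong suc (∣p∪q∣≡∣p∣+∣q∣ p q (λ x∈p x∈q → disjoint (there x∈p) (there x∈q))))
          (sym (+-suc ∣ p ∣ ∣ q ∣))
  ∣p∪q∣≡∣p∣+∣q∣ (false ∷ p) (false ∷ q) disjoint =
    ∣p∪q∣≡∣p∣+∣q∣ p q (λ x∈p x∈q → disjoint (there x∈p) (there x∈q))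

open Cardinality

module Arithmetic where
  open import Data.Nat using (_+_)
  open import Data.Nat.Properties
  open ≡-Reasoning

  ∸-shift : ∀ a {b c} → c ≤ b → a ∸ b ≡ (a ∸ c) ∸ (b ∸ c)
  ∸-shift a {b} {c} c≤b = begin
    a ∸ b                ≡⟨ cong (a ∸_) (m+[n∸m]≡n c≤b) ⟨
    a ∸ (c + (b ∸ c))    ≡⟨ ∸-+-assoc a c (b ∸ c) ⟨
    (a ∸ c) ∸ (b ∸ c)    ∎

  +-∸-shift : ∀ k {b c} → c ≤ b → (k + c) ∸ b ≡ k ∸ (b ∸ c)
  +-∸-shift k {b} {c} c≤b = begin
    (k + c) ∸ b                ≡⟨ cong ((k + c) ∸_) (m+[n∸m]≡n c≤b) ⟨
    (k + c) ∸ (c + (b ∸ c))    ≡⟨ cong (_∸ (c + (b ∸ c))) (+-comm k c) ⟩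
    (c + k) ∸ (c + (b ∸ c))    ≡⟨ [m+n]∸[m+o]≡n∸o c k (b ∸ c) ⟩
    k ∸ (b ∸ c)                ∎

  +-∸-+ : ∀ a b q k → b ≤ a → k ≤ q → (a + q) ∸ (b + k) ≡ (a ∸ b) + (q ∸ k)
  +-∸-+ a b q k b≤a k≤q = begin
    (a + q) ∸ (b + k)    ≡⟨ ∸-+-assoc (a + q) b k ⟨
    (a + q) ∸ b ∸ k      ≡⟨ cong (_∸ k) (+-∸-comm q b≤a) ⟩
    (a ∸ b + q) ∸ k      ≡⟨ +-∸-assoc (a ∸ b) k≤q ⟩
    (a ∸ b) + (q ∸ k)    ∎

  [m+k]∸[n+k]≡m∸n : ∀ m n k → (m + k) ∸ (n + k) ≡ m ∸ n
  [m+k]∸[n+k]≡m∸n m n k =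
    trans (cong₂ _∸_ (+-comm m k) (+-comm n k)) ([m+n]∸[m+o]≡n∸o k m n)

  [k+a]∸b<k⇒a<b : ∀ k a b → (k + a) ∸ b < k → a < b
  [k+a]∸b<k⇒a<b k a b short with a <? b
  ... | yes a<b = a<b
  ... | no  a≮b = ⊥-elim (≤⇒≯ k≤[k+a]∸b short)
    where
    k≤[k+a]∸b : k ≤ (k + a) ∸ b
    k≤[k+a]∸b rewrite +-∸-assoc k (≮⇒≥ a≮b) = m≤m+n k (a ∸ b)

open Arithmetic

module RingSums {c ℓ : Level} (R : CommutativeRing c ℓ) where
  open CommutativeRing R renaming (refl to ≈-refl; sym to ≈-sym; trans to ≈-trans)
  open TutteIn R
  open import Data.Nat using () renaming (_+_ to _ℕ+_)
  import Data.Nat.Properties as ℕₚ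
  open import Relation.Binary.Reasoning.Setoid setoid
  open import Algebra.Properties.CommutativeSemigroup +-commutativeSemigroup
    using (interchange)

  pow-+ : ∀ a m k → pow a (m ℕ+ k) ≈ pow a m * pow a k
  pow-+ a zero    k = ≈-sym (*-identityˡ (pow a k))
  pow-+ a (suc m) k = ≈-trans (*-congˡ (pow-+ a m k)) (≈-sym (*-assoc a (pow a m) (pow a k)))

  sumSub : ∀ {n} → Subset n → (Subset n → Carrier) → Carrier
  sumSub []          f = f []
  sumSub (false ∷ S) f = sumSub S (f ∘ (false ∷_))
  sumSub (true  ∷ S) f = sumSub S (f ∘ (false ∷_)) + sumSub S (f ∘ (true ∷_))

  syntax sumSub S (λ A → e) = ∑[ A ⊆ S ] e

  sumL-map-map : ∀ {m n} (f : Subset m → Carrier) (g : Subset n → Subset m) l →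
    sumL (map f (map g l)) ≡ sumL (map (f ∘ g) l)
  sumL-map-map f g []      = refl
  sumL-map-map f g (A ∷ l) = cong (f (g A) +_) (sumL-map-map f g l)

  sumL-++ : ∀ {n} (f : Subset n → Carrier) l₁ l₂ →
    sumL (map f (l₁ ++ l₂)) ≈ sumL (map f l₁) + sumL (map f l₂)
  sumL-++ f []       l₂ = ≈-sym (+-identityˡ _)
  sumL-++ f (A ∷ l₁) l₂ = ≈-trans (+-congˡ (sumL-++ f l₁ l₂)) (≈-sym (+-assoc _ _ _))

  sumL-subsetsOf : ∀ {n} (S : Subset n) (f : Subset n → Carrier) →
    sumL (map f (subsetsOf S)) ≈ sumSub S f
  sumL-subsetsOf []          f = +-identityʳ (f [])
  sumL-subsetsOf (false ∷ S) f =
    ≈-trans (reflexive (sumL-map-map f (false ∷_) (subsetsOf S))) (sumL-subsetsOf S _)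
  sumL-subsetsOf (true  ∷ S) f = begin
    sumL (map f (map (false ∷_) (subsetsOf S) ++ map (true ∷_) (subsetsOf S)))
      ≈⟨ sumL-++ f (map (false ∷_) (subsetsOf S)) (map (true ∷_) (subsetsOf S)) ⟩
    sumL (map f (map (false ∷_) (subsetsOf S))) + sumL (map f (map (true ∷_) (subsetsOf S)))
      ≡⟨ cong₂ _+_ (sumL-map-map f (false ∷_) (subsetsOf S))
                   (sumL-map-map f (true ∷_) (subsetsOf S)) ⟩
    sumL (map (f ∘ (false ∷_)) (subsetsOf S)) + sumL (map (f ∘ (true ∷_)) (subsetsOf S))
      ≈⟨ +-cong (sumL-subsetsOf S _) (sumL-subsetsOf S _) ⟩
    sumSub (true ∷ S) f ∎

  sumSub-cong : ∀ {n} (S : Subset n) {f g : Subset n → Carrier} →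
    (∀ A → A ⊆ S → f A ≈ g A) → sumSub S f ≈ sumSub S g
  sumSub-cong []          f≈g = f≈g [] (λ x∈[] → x∈[])
  sumSub-cong (false ∷ S) f≈g = sumSub-cong S (λ A A⊆S → f≈g (false ∷ A) (out⊆ A⊆S))
  sumSub-cong (true  ∷ S) f≈g =
    +-cong (sumSub-cong S (λ A A⊆S → f≈g (false ∷ A) (out⊆ A⊆S)))
           (sumSub-cong S (λ A A⊆S → f≈g (true ∷ A) (s⊆s A⊆S)))

  sumSub-+ : ∀ {n} (S : Subset n) (f g : Subset n → Carrier) →
    ∑[ A ⊆ S ] (f A + g A) ≈ sumSub S f + sumSub S g
  sumSub-+ []          f g = ≈-refl
  sumSub-+ (false ∷ S) f g = sumSub-+ S _ _
  sumSub-+ (true  ∷ S) f g =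
    ≈-trans (+-cong (sumSub-+ S _ _) (sumSub-+ S _ _)) (interchange _ _ _ _)

  sumSub-*ˡ : ∀ {n} (S : Subset n) (k : Carrier) (f : Subset n → Carrier) →
    ∑[ A ⊆ S ] (k * f A) ≈ k * sumSub S f
  sumSub-*ˡ []          k f = ≈-refl
  sumSub-*ˡ (false ∷ S) k f = sumSub-*ˡ S k _
  sumSub-*ˡ (true  ∷ S) k f =
    ≈-trans (+-cong (sumSub-*ˡ S k _) (sumSub-*ˡ S k _)) (≈-sym (distribˡ k _ _))

  sumSub-empty : ∀ {n} (S : Subset n) (f : Subset n → Carrier) → ∣ S ∣ ≡ 0 →
    sumSub S f ≈ f S
  sumSub-empty []          f _     = ≈-refl
  sumSub-empty (false ∷ S) f |S|≡0 = sumSub-empty S _ |S|≡0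

  sumSub-split : ∀ {n} (X : Subset n) (F : Subset n → Carrier) →
    sumSub ⊤ F ≈ ∑[ B ⊆ ∁ X ] ∑[ Y ⊆ X ] F (B ∪ Y)
  sumSub-split []          F = ≈-refl
  sumSub-split (false ∷ X) F = +-cong (sumSub-split X _) (sumSub-split X _)
  sumSub-split (true  ∷ X) F =
    ≈-trans (+-cong (sumSub-split X _) (sumSub-split X _)) (≈-sym (sumSub-+ (∁ X) _ _))

  module _ (x : Carrier) where
    private
      z : Carrier
      z = x + - 1#

    z+1≈x : z + 1# ≈ x
    z+1≈x = ≈-trans (+-assoc x (- 1#) 1#)
                  (≈-trans (+-congˡ (-‿inverseˡ 1#)) (+-identityʳ x))

    binomial : ∀ {n} (S : Subset n) →
      ∑[ Y ⊆ S ] pow z (∣ S ∣ ∸ ∣ Y ∣) ≈ pow x ∣ S ∣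
    binomial []          = ≈-refl
    binomial (false ∷ S) = binomial S
    binomial (true  ∷ S) = begin
      ∑[ Y ⊆ S ] pow z (suc ∣ S ∣ ∸ ∣ Y ∣) + ∑[ Y ⊆ S ] pow z (∣ S ∣ ∸ ∣ Y ∣)
        ≈⟨ +-congʳ (sumSub-cong S (λ Y Y⊆S →
              reflexive (cong (pow z) (ℕₚ.+-∸-assoc 1 (p⊆q⇒∣p∣≤∣q∣ Y⊆S))))) ⟩
      ∑[ Y ⊆ S ] (z * pow z (∣ S ∣ ∸ ∣ Y ∣)) + ∑[ Y ⊆ S ] pow z (∣ S ∣ ∸ ∣ Y ∣)
        ≈⟨ +-congʳ (sumSub-*ˡ S z _) ⟩
      z * ∑[ Y ⊆ S ] pow z (∣ S ∣ ∸ ∣ Y ∣) + ∑[ Y ⊆ S ] pow z (∣ S ∣ ∸ ∣ Y ∣)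
        ≈⟨ +-cong (*-congˡ (binomial S)) (binomial S) ⟩
      z * pow x ∣ S ∣ + pow x ∣ S ∣
        ≈⟨ +-congˡ (*-identityˡ _) ⟨
      z * pow x ∣ S ∣ + 1# * pow x ∣ S ∣
        ≈⟨ distribʳ (pow x ∣ S ∣) z 1# ⟨
      (z + 1#) * pow x ∣ S ∣
        ≈⟨ *-congʳ z+1≈x ⟩
      x * pow x ∣ S ∣ ∎

    sumSub-proper : ∀ {n} (S : Subset n) p (G : Subset n → Carrier) {c d} →
      ∣ S ∣ ≡ suc p → G S ≈ c → (∀ Y → Y ⊂ S → G Y ≈ d * pow z (p ∸ ∣ Y ∣)) →
      sumSub S G ≈ d * geom x p + c
    sumSub-proper (false ∷ S) p G |S|≡1+p G-top G-proper =
      sumSub-proper S p _ |S|≡1+p G-top (λ Y Y⊂S → G-proper (false ∷ Y) (out⊂ Y⊂S))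
    sumSub-proper (true ∷ S) p G {c} {d} |S|≡1+p G-top G-proper =
      ≈-trans (+-congʳ withoutFirst) (withFirst p |S|≡p G-proper)
      where
      |S|≡p : ∣ S ∣ ≡ p
      |S|≡p = ℕₚ.suc-injective |S|≡1+p

      -- Subsets missing the first member of S are all proper: binomial theorem.
      withoutFirst : ∑[ Y ⊆ S ] G (false ∷ Y) ≈ d * pow x p
      withoutFirst = begin
        ∑[ Y ⊆ S ] G (false ∷ Y)
          ≈⟨ sumSub-cong S (λ Y Y⊆S → G-proper (false ∷ Y) (out⊂in Y⊆S)) ⟩
        ∑[ Y ⊆ S ] (d * pow z (p ∸ ∣ Y ∣))
          ≈⟨ sumSub-*ˡ S d _ ⟩
        d * ∑[ Y ⊆ S ] pow z (p ∸ ∣ Y ∣)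
          ≡⟨ cong (λ k → d * ∑[ Y ⊆ S ] pow z (k ∸ ∣ Y ∣)) (sym |S|≡p) ⟩
        d * ∑[ Y ⊆ S ] pow z (∣ S ∣ ∸ ∣ Y ∣)
          ≈⟨ *-congˡ (binomial S) ⟩
        d * pow x ∣ S ∣
          ≡⟨ cong (λ k → d * pow x k) |S|≡p ⟩
        d * pow x p ∎

      withFirst : ∀ q → ∣ S ∣ ≡ q →
        (∀ Y → Y ⊂ true ∷ S → G Y ≈ d * pow z (q ∸ ∣ Y ∣)) →
        d * pow x q + ∑[ Y ⊆ S ] G (true ∷ Y) ≈ d * geom x q + c
      withFirst zero    |S|≡0 _ = +-congˡ (≈-trans (sumSub-empty S _ |S|≡0) G-top)
      withFirst (suc q) |S|≡1+q G-proper′ = begin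
        d * pow x (suc q) + ∑[ Y ⊆ S ] G (true ∷ Y)
          ≈⟨ +-congˡ (sumSub-proper S q _ |S|≡1+q G-top
                        (λ Y Y⊂S → G-proper′ (true ∷ Y) (s⊂s Y⊂S))) ⟩
        d * pow x (suc q) + (d * geom x q + c)
          ≈⟨ +-assoc _ _ _ ⟨
        (d * pow x (suc q) + d * geom x q) + c
          ≈⟨ +-congʳ (distribˡ d _ _) ⟨
        d * geom x (suc q) + c ∎

module MatroidRank {n : ℕ} (r : Subset n → ℕ) (isRank : IsMatroidRank r) where
  open IsMatroidRank isRank
  open import Data.Nat using (_+_; _≤?_; _<?_; z≤n; s≤s)
  open import Data.Nat.Properties

  rank-≡ : ∀ {A B} → A ⊆ B → B ⊆ A → r A ≡ r B
  rank-≡ A⊆B B⊆A = ≤-antisym (rank-mono A⊆B) (rank-mono B⊆A)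

  rank-⊥ : r ⊥ ≡ 0
  rank-⊥ = n≤0⇒n≡0 (≤-trans (rank-≤-card ⊥) (≤-reflexive (∣⊥∣≡0 n)))

  dual-⊥-independent : Independent (dualRank r) ⊥
  dual-⊥-independent = begin
    (∣ ∅ ∣ + r (∁ ∅)) ∸ r ⊤   ≡⟨ cong₂ (λ k ρ → (k + ρ) ∸ r ⊤) (∣⊥∣≡0 n) ∁⊥-spans ⟩
    r ⊤ ∸ r ⊤                 ≡⟨ n∸n≡0 (r ⊤) ⟩
    0                         ≡⟨ ∣⊥∣≡0 n ⟨
    ∣ ∅ ∣                     ∎
    where
    open ≡-Reasoning
    ∅ : Subset n
    ∅ = ⊥
    ∁⊥-spans : r (∁ ∅) ≡ r ⊤
    ∁⊥-spans = rank-≡ ⊆⊤ (λ _ → x∉p⇒x∈∁p ∉⊥)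

  noncoloop-spans : ∀ e → ¬ Loop (dualRank r) e → r ⊤ ≤ r (∁ ⁅ e ⁆)
  noncoloop-spans e notLoop with r ⊤ ≤? r (∁ ⁅ e ⁆)
  ... | yes spans = spans
  ... | no  drops = ⊥-elim (notLoop (dependent , minus-independent))
    where
    dependent : Dependent (dualRank r) ⁅ e ⁆
    dependent rewrite ∣⁅x⁆∣≡1 e | m≤n⇒m∸n≡0 (≰⇒> drops) = s≤s z≤n
    minus-independent : ∀ e′ → e′ ∈ ⁅ e ⁆ → Independent (dualRank r) (⁅ e ⁆ - e′)
    minus-independent e′ e′∈⁅e⁆
      rewrite ∣p∣≡0⇒p≡⊥ (⁅ e ⁆ - e′)
                (suc-injective (trans (∣p-x∣+1≡∣p∣ ⁅ e ⁆ e′∈⁅e⁆) (∣⁅x⁆∣≡1 e)))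
      = dual-⊥-independent

  -- A pair that is dependent in the dual meets every basis: removing it
  -- lowers the rank of the ground set.
  cocircuit-pair-drops : ∀ e f → Dependent (dualRank r) (⁅ e ⁆ ∪ ⁅ f ⁆) →
    r (∁ (⁅ e ⁆ ∪ ⁅ f ⁆)) < r ⊤
  cocircuit-pair-drops e f = [k+a]∸b<k⇒a<b ∣ ⁅ e ⁆ ∪ ⁅ f ⁆ ∣ _ _

  -- If e, f are in series and f is not a coloop, then adding e to a set
  -- avoiding both raises the rank by one (submodularity against E − {e,f}).
  series-step : ∀ {e f S} → e ≢ f → r ⊤ ≤ r (∁ ⁅ f ⁆) → r (∁ (⁅ e ⁆ ∪ ⁅ f ⁆)) < r ⊤ →
    e ∉ S → f ∉ S → r (S ∪ ⁅ e ⁆) ≡ suc (r S)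
  series-step {e} {f} {S} e≢f f-spans pair-drops e∉S f∉S = ≤-antisym upper lower
    where
    A Bᶜ : Subset n
    A  = S ∪ ⁅ e ⁆
    Bᶜ = ∁ (⁅ e ⁆ ∪ ⁅ f ⁆)
    covers : ∁ ⁅ f ⁆ ⊆ A ∪ Bᶜ
    covers {x} x∉f with x ≟ᶠ e
    ... | yes refl = p⊆p∪q Bᶜ (q⊆p∪q S ⁅ e ⁆ (x∈⁅x⁆ e))
    ... | no  x≢e  = q⊆p∪q A Bᶜ (x∉p⇒x∈∁p (∉∪ (x≢y⇒x∉⁅y⁆ x≢e) (x∈∁p⇒x∉p x∉f)))
    kept : S ⊆ A ∩ Bᶜ
    kept {x} x∈S = x∈p∩q⁺ (p⊆p∪q ⁅ e ⁆ x∈S , x∉p⇒x∈∁p (∉∪ (avoid e∉S) (avoid f∉S)))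
      where
      avoid : ∀ {y} → y ∉ S → x ∉ ⁅ y ⁆
      avoid {y} y∉S x∈y = y∉S (subst (_∈ S) (x∈⁅y⁆⇒x≡y y x∈y) x∈S)
    lower : suc (r S) ≤ r A
    lower = +-cancelʳ-< (r Bᶜ) (r S) (r A) (begin-strict
      r S + r Bᶜ   ≡⟨ +-comm (r S) (r Bᶜ) ⟩
      r Bᶜ + r S   <⟨ +-monoˡ-< (r S) pair-drops ⟩
      r ⊤ + r S    ≤⟨ +-mono-≤ (≤-trans f-spans (rank-mono covers)) (rank-mono kept) ⟩
      r (A ∪ Bᶜ) + r (A ∩ Bᶜ) ≤⟨ rank-submod A Bᶜ ⟩
      r A + r Bᶜ   ∎)
      where open ≤-Reasoning
    upper : r A ≤ suc (r S)
    upper = begin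
      r A                     ≤⟨ m≤m+n (r A) (r (S ∩ ⁅ e ⁆)) ⟩
      r A + r (S ∩ ⁅ e ⁆)     ≤⟨ rank-submod S ⁅ e ⁆ ⟩
      r S + r ⁅ e ⁆           ≤⟨ +-monoʳ-≤ (r S) (≤-trans (rank-≤-card ⁅ e ⁆)
                                                         (≤-reflexive (∣⁅x⁆∣≡1 e))) ⟩
      r S + 1                 ≡⟨ +-comm (r S) 1 ⟩
      suc (r S)               ∎
      where open ≤-Reasoning

  module SeriesSet (X : Subset n) (series : ParallelSet (dualRank r) X) where

    private
      spans-without : ∀ {f} → f ∈ X → r ⊤ ≤ r (∁ ⁅ f ⁆)
      spans-without {f} f∈X = noncoloop-spans f (proj₂ series f f∈X)

      pair-drops : ∀ {e f} → e ∈ X → f ∈ X → e ≢ f → r (∁ (⁅ e ⁆ ∪ ⁅ f ⁆)) < r ⊤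
      pair-drops {e} {f} e∈X f∈X e≢f =
        cocircuit-pair-drops e f (proj₁ (proj₂ (proj₁ series e f e∈X f∈X e≢f)))

      outside-X : ∀ {B x} → B ⊆ ∁ X → x ∈ X → x ∉ B
      outside-X B⊆∁X x∈X x∈B = x∈∁p⇒x∉p (B⊆∁X x∈B) x∈X

    free : ∀ m {B Y} → ∣ Y ∣ ≡ m → B ⊆ ∁ X → Y ⊂ X → r (B ∪ Y) ≡ r B + m
    free zero {B} {Y} |Y|≡0 _ _ = begin
      r (B ∪ Y)   ≡⟨ cong (λ Z → r (B ∪ Z)) (∣p∣≡0⇒p≡⊥ Y |Y|≡0) ⟩
      r (B ∪ ⊥)   ≡⟨ cong r (∪-identityʳ B) ⟩
      r B         ≡⟨ +-identityʳ (r B) ⟨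
      r B + 0     ∎
      where open ≡-Reasoning
    free (suc m) {B} {Y} |Y|≡1+m B⊆∁X (Y⊆X , f , f∈X , f∉Y)
      with nonempty Y |Y|≡1+m
    ... | e , e∈Y = begin
      r (B ∪ Y)                   ≡⟨ cong (λ Z → r (B ∪ Z)) (p-x∪⁅x⁆≡p e∈Y) ⟨
      r (B ∪ ((Y - e) ∪ ⁅ e ⁆))   ≡⟨ cong r (∪-assoc B (Y - e) ⁅ e ⁆) ⟨
      r (S ∪ ⁅ e ⁆)               ≡⟨ series-step e≢f (spans-without f∈X)
                                        (pair-drops (Y⊆X e∈Y) f∈X e≢f) e∉S f∉S ⟩
      suc (r S)                   ≡⟨ cong suc (free m |Y-e|≡m B⊆∁X Y-e⊂X) ⟩
      suc (r B + m)               ≡⟨ +-suc (r B) m ⟨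
      r B + suc m                 ∎
      where
      open ≡-Reasoning
      S : Subset n
      S = B ∪ (Y - e)
      e≢f : e ≢ f
      e≢f refl = f∉Y e∈Y
      e∉S : e ∉ S
      e∉S = ∉∪ (outside-X B⊆∁X (Y⊆X e∈Y)) (x∉p-x Y e)
      f∉S : f ∉ S
      f∉S = ∉∪ (outside-X B⊆∁X f∈X) (f∉Y ∘ p─q⊆p Y ⁅ e ⁆)
      |Y-e|≡m : ∣ Y - e ∣ ≡ m
      |Y-e|≡m = suc-injective (trans (∣p-x∣+1≡∣p∣ Y e∈Y) |Y|≡1+m)
      Y-e⊂X : Y - e ⊂ X
      Y-e⊂X = Y⊆X ∘ p─q⊆p Y ⁅ e ⁆ , f , f∈X , f∉Y ∘ p─q⊆p Y ⁅ e ⁆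

    -- A series set that is not a circuit is independent, since each
    -- deletion X − e is independent by freeness.
    independent : ¬ Circuit r X → r X ≡ ∣ X ∣
    independent notCircuit with r X <? ∣ X ∣
    ... | no  r≮∣X∣ = ≤-antisym (rank-≤-card X) (≮⇒≥ r≮∣X∣)
    ... | yes r<∣X∣ = ⊥-elim (notCircuit (r<∣X∣ , deletion-independent))
      where
      deletion-independent : ∀ e → e ∈ X → Independent r (X - e)
      deletion-independent e e∈X = begin
        r (X - e)             ≡⟨ cong r (∪-identityˡ (X - e)) ⟨
        r (⊥ ∪ (X - e))       ≡⟨ free _ refl (⊥-elim ∘ ∉⊥) (x∈p⇒p-x⊂p e∈X) ⟩
        r ⊥ + ∣ X - e ∣       ≡⟨ cong (_+ ∣ X - e ∣) rank-⊥ ⟩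
        ∣ X - e ∣             ∎
        where open ≡-Reasoning

    -- Deleting all of X but one member f lowers the rank by |X| − 1,
    -- because E − X together with X − f still spans (f is no coloop).
    rank-⊤ : ∀ {p} → ∣ X ∣ ≡ suc p → r ⊤ ≡ r (∁ X) + p
    rank-⊤ {p} |X|≡1+p with nonempty X |X|≡1+p
    ... | f , f∈X = begin
      r ⊤                 ≡⟨ ≤-antisym (≤-trans (spans-without f∈X) (rank-mono cover))
                                      (rank-mono ⊆⊤) ⟩
      r (∁ X ∪ (X - f))   ≡⟨ free p |X-f|≡p (λ x∈∁X → x∈∁X) (x∈p⇒p-x⊂p f∈X) ⟩
      r (∁ X) + p         ∎
      where
      open ≡-Reasoning
      |X-f|≡p : ∣ X - f ∣ ≡ p
      |X-f|≡p = suc-injective (trans (∣p-x∣+1≡∣p∣ X f∈X) |X|≡1+p)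
      cover : ∁ ⁅ f ⁆ ⊆ ∁ X ∪ (X - f)
      cover {x} x∉f with x ∈? X
      ... | yes x∈X = q⊆p∪q (∁ X) (X - f) (x∈p∧x≢y⇒x∈p-y x∈X (x∉⁅y⁆⇒x≢y (x∈∁p⇒x∉p x∉f)))
      ... | no  x∉X = p⊆p∪q (X - f) (x∉p⇒x∈∁p x∉X)

    module Exponents {p : ℕ} (|X|≡1+p : ∣ X ∣ ≡ suc p) (notCircuit : ¬ Circuit r X) where
      open ≡-Reasoning

      deletion-corank : ∀ {B Y} → B ⊆ ∁ X → Y ⊂ X →
        r ⊤ ∸ r (B ∪ Y) ≡ (r (∁ X) ∸ r B) + (p ∸ ∣ Y ∣)
      deletion-corank {B} {Y} B⊆∁X Y⊂X = begin
        r ⊤ ∸ r (B ∪ Y)                 ≡⟨ cong₂ _∸_ (rank-⊤ |X|≡1+p) (free _ refl B⊆∁X Y⊂X) ⟩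
        (r (∁ X) + p) ∸ (r B + ∣ Y ∣)   ≡⟨ +-∸-+ (r (∁ X)) (r B) p (∣ Y ∣) (rank-mono B⊆∁X) |Y|≤p ⟩
        (r (∁ X) ∸ r B) + (p ∸ ∣ Y ∣)   ∎
        where
        |Y|≤p : ∣ Y ∣ ≤ p
        |Y|≤p = s≤s⁻¹ (≤-trans (p⊂q⇒∣p∣<∣q∣ Y⊂X) (≤-reflexive |X|≡1+p))

      deletion-nullity : ∀ {B Y} → B ⊆ ∁ X → Y ⊂ X →
        ∣ B ∪ Y ∣ ∸ r (B ∪ Y) ≡ ∣ B ∣ ∸ r B
      deletion-nullity {B} {Y} B⊆∁X Y⊂X@(Y⊆X , _) = begin
        ∣ B ∪ Y ∣ ∸ r (B ∪ Y)           ≡⟨ cong₂ _∸_ (∣p∪q∣≡∣p∣+∣q∣ B Y disjoint)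
                                                     (free _ refl B⊆∁X Y⊂X) ⟩
        (∣ B ∣ + ∣ Y ∣) ∸ (r B + ∣ Y ∣)   ≡⟨ [m+k]∸[n+k]≡m∸n (∣ B ∣) (r B) (∣ Y ∣) ⟩
        ∣ B ∣ ∸ r B                     ∎
        where
        disjoint : ∀ {x} → x ∈ B → x ∉ Y
        disjoint x∈B x∈Y = outside-X B⊆∁X (Y⊆X x∈Y) x∈B

      contraction-corank : ∀ {B} →
        r ⊤ ∸ r (B ∪ X) ≡ (r (∁ X ∪ X) ∸ r X) ∸ (r (B ∪ X) ∸ r X)
      contraction-corank {B} = begin
        r ⊤ ∸ r (B ∪ X)                            ≡⟨ ∸-shift (r ⊤) (rank-mono (q⊆p∪q B X)) ⟩
        (r ⊤ ∸ r X) ∸ (r (B ∪ X) ∸ r X)            ≡⟨ cong (λ A → (r A ∸ r X) ∸ (r (B ∪ X) ∸ r X))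
                                                          (trans (∪-comm (∁ X) X) (p∪∁p≡⊤ X)) ⟨
        (r (∁ X ∪ X) ∸ r X) ∸ (r (B ∪ X) ∸ r X)    ∎

      contraction-nullity : ∀ {B} → B ⊆ ∁ X →
        ∣ B ∪ X ∣ ∸ r (B ∪ X) ≡ ∣ B ∣ ∸ (r (B ∪ X) ∸ r X)
      contraction-nullity {B} B⊆∁X = begin
        ∣ B ∪ X ∣ ∸ r (B ∪ X)          ≡⟨ cong (_∸ r (B ∪ X)) (∣p∪q∣≡∣p∣+∣q∣ B X disjoint) ⟩
        (∣ B ∣ + ∣ X ∣) ∸ r (B ∪ X)     ≡⟨ cong (λ k → (∣ B ∣ + k) ∸ r (B ∪ X)) (independent notCircuit) ⟨
        (∣ B ∣ + r X) ∸ r (B ∪ X)       ≡⟨ +-∸-shift (∣ B ∣) (rank-mono (q⊆p∪q B X)) ⟩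
        ∣ B ∣ ∸ (r (B ∪ X) ∸ r X)       ∎
        where
        disjoint : ∀ {x} → x ∈ B → x ∉ X
        disjoint x∈B x∈X = outside-X B⊆∁X x∈X x∈B

module SeriesClassSummands {c ℓ : Level} (R : CommutativeRing c ℓ) {n : ℕ} (M : Matroid n)
    (X : Subset n) {p : ℕ} (seriesClass : SeriesClass M X) (|X|≡1+p : ∣ X ∣ ≡ suc p)
    (notCircuit : ¬ Circuit (Matroid.rank M) X) (x y : CommutativeRing.Carrier R) where
  open CommutativeRing R renaming (refl to ≈-refl; sym to ≈-sym; trans to ≈-trans)
  open TutteIn R
  open RingSums R
  open import Data.Nat using () renaming (_+_ to _ℕ+_)
  open MatroidRank (Matroid.rank M) (Matroid.isRank M)
  open SeriesSet X (proj₁ seriesClass)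
  open Exponents |X|≡1+p notCircuit
  open import Algebra.Properties.CommutativeSemigroup *-commutativeSemigroup using (xy∙z≈xz∙y)
  open import Relation.Binary.Reasoning.Setoid setoid

  r : Subset n → ℕ
  r = Matroid.rank M

  r/X : Subset n → ℕ
  r/X A = r (A ∪ X) ∸ r X

  summand : (Subset n → ℕ) → Subset n → Subset n → Carrier
  summand ρ S A = pow (x + - 1#) (ρ S ∸ ρ A) * pow (y + - 1#) (∣ A ∣ ∸ ρ A)

  contraction-summand : ∀ {B} → B ⊆ ∁ X → summand r ⊤ (B ∪ X) ≈ summand r/X (∁ X) B
  contraction-summand B⊆∁X = reflexive (cong₂ (λ a b → pow (x + - 1#) a * pow (y + - 1#) b)
                                                contraction-corank (contraction-nullity B⊆∁X))

  deletion-summand : ∀ {B Y} → B ⊆ ∁ X → Y ⊂ X →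
    summand r ⊤ (B ∪ Y) ≈ summand r (∁ X) B * pow (x + - 1#) (p ∸ ∣ Y ∣)
  deletion-summand {B} {Y} B⊆∁X Y⊂X = begin
    summand r ⊤ (B ∪ Y)
      ≡⟨ cong₂ (λ a b → pow (x + - 1#) a * pow (y + - 1#) b)
               (deletion-corank B⊆∁X Y⊂X) (deletion-nullity B⊆∁X Y⊂X) ⟩
    pow (x + - 1#) ((r (∁ X) ∸ r B) ℕ+ (p ∸ ∣ Y ∣)) * pow (y + - 1#) (∣ B ∣ ∸ r B)
      ≈⟨ *-congʳ (pow-+ (x + - 1#) (r (∁ X) ∸ r B) (p ∸ ∣ Y ∣)) ⟩
    (pow (x + - 1#) (r (∁ X) ∸ r B) * pow (x + - 1#) (p ∸ ∣ Y ∣)) * pow (y + - 1#) (∣ B ∣ ∸ r B)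
      ≈⟨ xy∙z≈xz∙y _ _ _ ⟩
    summand r (∁ X) B * pow (x + - 1#) (p ∸ ∣ Y ∣) ∎

  fibre : ∀ B → B ⊆ ∁ X →
    ∑[ Y ⊆ X ] summand r ⊤ (B ∪ Y) ≈ geom x p * summand r (∁ X) B + summand r/X (∁ X) B
  fibre B B⊆∁X = ≈-trans
    (sumSub-proper x X p (λ Y → summand r ⊤ (B ∪ Y)) |X|≡1+p
       (contraction-summand B⊆∁X) (λ Y → deletion-summand B⊆∁X))
    (+-congʳ (*-comm _ _))

mainTheorem1 : ∀ {c ℓ : Level} (R : CommutativeRing c ℓ) {n : ℕ} (M : Matroid n)
    (X : Subset n) (p : ℕ) → SeriesClass M X → ∣ X ∣ ≡ suc p →
    ¬ Circuit (Matroid.rank M) X → (x y : CommutativeRing.Carrier R) →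
    let open CommutativeRing R
        open TutteIn R
    in tutte M x y ≈ geom x p * tutteDelete M X x y + tutteContract M X x y
mainTheorem1 R M X p seriesClass |X|≡1+p notCircuit x y = begin
  tutte M x y
    ≈⟨ sumL-subsetsOf ⊤ (summand r ⊤) ⟩
  ∑[ A ⊆ ⊤ ] summand r ⊤ A
    ≈⟨ sumSub-split X (summand r ⊤) ⟩
  ∑[ B ⊆ ∁ X ] ∑[ Y ⊆ X ] summand r ⊤ (B ∪ Y)
    ≈⟨ sumSub-cong (∁ X) fibre ⟩
  ∑[ B ⊆ ∁ X ] (geom x p * summand r (∁ X) B + summand r/X (∁ X) B)
    ≈⟨ sumSub-+ (∁ X) _ _ ⟩
  ∑[ B ⊆ ∁ X ] (geom x p * summand r (∁ X) B) + ∑[ B ⊆ ∁ X ] summand r/X (∁ X) B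
    ≈⟨ +-congʳ (sumSub-*ˡ (∁ X) (geom x p) _) ⟩
  geom x p * ∑[ B ⊆ ∁ X ] summand r (∁ X) B + ∑[ B ⊆ ∁ X ] summand r/X (∁ X) B
    ≈⟨ +-cong (*-congˡ (sumL-subsetsOf (∁ X) _)) (sumL-subsetsOf (∁ X) _) ⟨
  geom x p * tutteDelete M X x y + tutteContract M X x y ∎
  where
  open CommutativeRing R using (_+_; _*_; setoid; +-cong; +-congʳ; *-congˡ)
  open TutteIn R using (tutte; tutteDelete; tutteContract; geom)
  open RingSums R using (sumSub; sumL-subsetsOf; sumSub-split; sumSub-cong; sumSub-+; sumSub-*ˡ)
  open SeriesClassSummands R M X seriesClass |X|≡1+p notCircuit x y using (r; r/X; summand; fibre)
  open import Relation.Binary.Reasoning.Setoid setoid
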